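{- Let $(G,w,k_1,k_2,k_3)$ be an instance of M-EPVCB with $\frac{k_2}{k_3}\ge\Delta(G)$. Then it is a "yes"-instance of M-EPVCB if and only if $(G,w,k_1,k_2)$ is a "yes"-instance of EPVCB.
   Context: Graphs are finite, simple, undirected; $\Delta(G)$ is the maximum degree. For $V_0\subseteq V(G)$, $E(V_0)$ denotes the set of edges with at least one endpoint in $V_0$. EPVCB: given a bipartite graph $G=(V,E)$, $w:E\to\mathbb{N}$ (positive integers), and positive integers $k_1,k_2$, decide whether there exists $V_0\subseteq V$ with $|V_0|\le k_1$ and $\sum_{e\in E(V_0)}w(e)\ge k_2$. M-EPVCB: given additionally a positive integer $k_3$, decide whether there exists $V_0\subseteq V$ with $|V_0|\le k_1$ such that $\sum_{e\in E(V_0)}w(e)\ge k_2$ and $E(V_0)$ contains a matching $M$ with $\sum_{e\in M}w(e)\ge k_3$. -}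

module Defs where

open import Data.Nat using (ℕ; _+_; _*_; _<_; _≤_; _⊔_)
open import Data.Bool using (Bool; true; false; _∨_)
open import Data.Fin using (Fin; toℕ) renaming (_≟_ to _Fin≟_)
open import Relation.Nullary.Decidable using (⌊_⌋)
open import Data.Fin.Subset using (Subset; _∈_; ∣_∣)
open import Data.List using (List; []; _∷_; length; map; filterᵇ; allFin; foldr)
open import Data.Nat.ListAction using (sum)
open import Data.List.Relation.Unary.Unique.Propositional using (Unique)
open import Data.List.Relation.Unary.All using (All)
open import Data.List.Relation.Unary.AllPairs using (AllPairs)
open import Data.List.Membership.Propositional using () renaming (_∈_ to _∈L_)
open import Data.Vec using (lookup)
open import Data.Product using (_×_; _,_; proj₁; proj₂; ∃)
open import Data.Sum using (_⊎_)
open import Relation.Binary.PropositionalEquality using (_≡_; _≢_)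
open import Relation.Nullary using (¬_)

-- An edge of a graph on vertex set Fin n is an unordered pair {u , v},
-- represented canonically as an ordered pair (u , v) with toℕ u < toℕ v.
Edge : ℕ → Set
Edge n = Fin n × Fin n

record Graph : Set where
  field
    n       : ℕ
    edges   : List (Edge n)
    ordered : All (λ e → toℕ (proj₁ e) < toℕ (proj₂ e)) edges
    unique  : Unique edges
open Graph public

Bipartite : Graph → Set
Bipartite G = ∃ λ (c : Fin (n G) → Bool) →
  All (λ e → c (proj₁ e) ≢ c (proj₂ e)) (edges G)

-- Edge weights w : E → positive integers (given on all pairs, required
-- positive on edges; values off the edge set are irrelevant).
PositiveWeights : (G : Graph) → (Edge (n G) → ℕ) → Set
PositiveWeights G w = All (λ e → 1 ≤ w e) (edges G)

incidentᵇ : ∀ {m} → Fin m → Edge m → Bool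
incidentᵇ v (a , b) = ⌊ v Fin≟ a ⌋ ∨ ⌊ v Fin≟ b ⌋

degree : (G : Graph) → Fin (n G) → ℕ
degree G v = length (filterᵇ (incidentᵇ v) (edges G))

Δ : Graph → ℕ
Δ G = foldr _⊔_ 0 (map (degree G) (allFin (n G)))

touchesᵇ : ∀ {m} → Subset m → Edge m → Bool
touchesᵇ V₀ (a , b) = lookup V₀ a ∨ lookup V₀ b

E[_] : (G : Graph) → Subset (n G) → List (Edge (n G))
E[ G ] V₀ = filterᵇ (touchesᵇ V₀) (edges G)

weight : ∀ {m} → (Edge m → ℕ) → List (Edge m) → ℕ
weight w F = sum (map w F)

Disjoint : ∀ {m} → Edge m → Edge m → Set
Disjoint (a , b) (c , d) = a ≢ c × a ≢ d × b ≢ c × b ≢ d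

-- M (a list of edges) is a matching contained in the edge list F:
-- every edge of M lies in F, and the edges of M are pairwise vertex-disjoint
-- (which in particular makes them pairwise distinct).
MatchingIn : ∀ {m} → List (Edge m) → List (Edge m) → Set
MatchingIn F M = All (λ e → e ∈L F) M × AllPairs Disjoint M

EPVCB : (G : Graph) → (Edge (n G) → ℕ) → ℕ → ℕ → Set
EPVCB G w k₁ k₂ = ∃ λ (V₀ : Subset (n G)) →
  ∣ V₀ ∣ ≤ k₁ × k₂ ≤ weight w (E[ G ] V₀)

M-EPVCB : (G : Graph) → (Edge (n G) → ℕ) → ℕ → ℕ → ℕ → Set
M-EPVCB G w k₁ k₂ k₃ = ∃ λ (V₀ : Subset (n G)) →
  ∣ V₀ ∣ ≤ k₁ × k₂ ≤ weight w (E[ G ] V₀) ×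
  ∃ λ (M : List (Edge (n G))) → MatchingIn (E[ G ] V₀) M × k₃ ≤ weight w M

-- If V₀ witnesses EPVCB, then E(V₀) is the edge set of a bipartite graph of maximum degree at
-- most Δ(G). By König's edge-colouring theorem it splits into Δ(G) matchings, one of which
-- therefore weighs at least w(E(V₀))/Δ(G) ≥ k₂/Δ(G) ≥ k₃. König's theorem is proved by colouring the edges one at a time: for a new edge uv
-- pick a colour a free at u and b free at v; if a ≠ b, interchange a and b along the
-- a/b-alternating path (Kempe chain) starting at v. By bipartiteness that path cannot reach u,
-- so afterwards a is free at both u and v.
module Submission where

open import Data.Bool using (Bool; true; false; T; if_then_else_; _xor_)
open import Data.Fin using (Fin; toℕ; fromℕ<; _≟_; zero; suc)
open import Data.Fin.Permutation.Components using (transpose; transpose-inverse)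
open import Data.Fin.Properties using (any?; pigeonhole; toℕ<n; toℕ-fromℕ<; ¬∀⟶∃¬; <⇒≢)
open import Data.List using (List; []; _∷_; map; length; filter; filterᵇ; foldr; lookup)
open import Data.List.Membership.Propositional using (_∉_; find; lose) renaming (_∈_ to _∈L_)
open import Data.List.Membership.Propositional.Properties
  using (∈-map⁺; ∈-map⁻; ∈-filter⁺; ∈-filter⁻; ∈-allFin)
open import Data.List.Properties using (filter-accept; map-∘)
open import Data.List.Relation.Binary.Sublist.Propositional.Properties using (filter-⊆; length-mono-≤)
import Data.List.Relation.Binary.Sublist.Propositional.Properties as Sublist
open import Data.List.Relation.Unary.All using (All; []; _∷_)
import Data.List.Relation.Unary.All as All
open import Data.List.Relation.Unary.All.Properties
  using (all-filter) renaming (map⁺ to All-map⁺; filter⁺ to All-filter⁺)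
open import Data.List.Relation.Unary.AllPairs using (AllPairs; []; _∷_)
import Data.List.Relation.Unary.AllPairs.Properties as AllPairs
import Data.List.Relation.Unary.Any as Any
open import Data.List.Relation.Unary.Any using (here; there; index)
open import Data.List.Relation.Unary.Any.Properties using (lookup-index)
open import Data.Nat using (ℕ; zero; suc; _+_; _*_; _∸_; _≤_; _<_; _⊔_; _≤?_; _<?_; z≤n; s≤s)
open import Data.Nat.GeneralisedArithmetic using (fold; fold-+)
open import Data.Nat.Induction using (<-rec)
open import Data.Nat.Properties
  using (≤-refl; ≤-trans; <⇒≤; <-≤-trans; n≤1+n; n<1+n; ≮⇒≥; ≰⇒>; m∸n+n≡m; m≤m⊔n;
         m≤n⊔m; +-monoʳ-<; +-monoˡ-≤; +-suc; +-cancelˡ-≤; +-identityʳ; +-0-commutativeMonoid;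
         module ≤-Reasoning)
open import Data.Product using (∃; _×_; _,_; proj₁; proj₂)
import Data.Product as Product
open import Data.Sum using (_⊎_; inj₁; inj₂)
open import Function using (id; _∘_; _on_)
open import Function.Bundles using (_⇔_; mk⇔)
open import Relation.Binary.PropositionalEquality
  using (_≡_; _≢_; refl; sym; trans; cong; cong₂; subst; module ≡-Reasoning)
open import Relation.Nullary using (¬_; Dec; yes; no; does; contradiction)
open import Relation.Nullary.Decidable using (_⊎-dec_; _×-dec_; map′; dec-true; dec-false; T?)
open import Relation.Unary using (Decidable)
open import Algebra.Properties.CommutativeMonoid.Sum +-0-commutativeMonoid
  using (sum-syntax; ∑-distrib-+; sum-cong-≗; sum-replicate-zero)

open import Defs

infix 4 _∈ₑ_ _∈ₑ?_

_∈ₑ_ : ∀ {N} → Fin N → Edge N → Set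
x ∈ₑ (p , q) = x ≡ p ⊎ x ≡ q

_∈ₑ?_ : ∀ {N} (x : Fin N) (e : Edge N) → Dec (x ∈ₑ e)
x ∈ₑ? (p , q) = x ≟ p ⊎-dec x ≟ q

∈ₑ⇒incidentᵇ : ∀ {N} {x : Fin N} e → x ∈ₑ e → T (incidentᵇ x e)
∈ₑ⇒incidentᵇ {x = x} (p , q) (inj₁ refl) with x ≟ x
... | yes _ = _
... | no x≢x = contradiction refl x≢x
∈ₑ⇒incidentᵇ {x = x} (p , q) (inj₂ refl) with x ≟ p | x ≟ x
... | yes _ | _ = _
... | no _ | yes _ = _
... | no _ | no x≢x = contradiction refl x≢x

disjoint⊎shared : ∀ {N} (e f : Edge N) → Disjoint e f ⊎ ∃ λ x → x ∈ₑ e × x ∈ₑ f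
disjoint⊎shared (p , q) (r , s) with p ≟ r | p ≟ s | q ≟ r | q ≟ s
... | yes p≡r | _ | _ | _ = inj₂ (p , inj₁ refl , inj₁ p≡r)
... | no _ | yes p≡s | _ | _ = inj₂ (p , inj₁ refl , inj₂ p≡s)
... | no _ | no _ | yes q≡r | _ = inj₂ (q , inj₂ refl , inj₁ q≡r)
... | no _ | no _ | no _ | yes q≡s = inj₂ (q , inj₂ refl , inj₂ q≡s)
... | no p≢r | no p≢s | no q≢r | no q≢s = inj₁ (p≢r , p≢s , q≢r , q≢s)

shared⇒¬disjoint : ∀ {N} {x : Fin N} e f → x ∈ₑ e → x ∈ₑ f → ¬ Disjoint e f
shared⇒¬disjoint _ _ (inj₁ refl) (inj₁ refl) (p≢r , _) = p≢r refl
shared⇒¬disjoint _ _ (inj₁ refl) (inj₂ refl) (_ , p≢s , _) = p≢s refl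
shared⇒¬disjoint _ _ (inj₂ refl) (inj₁ refl) (_ , _ , q≢r , _) = q≢r refl
shared⇒¬disjoint _ _ (inj₂ refl) (inj₂ refl) (_ , _ , _ , q≢s) = q≢s refl

opposite : ∀ {N} → Fin N → Edge N → Fin N
opposite x (p , q) = if does (x ≟ p) then q else p

opposite-spec : ∀ {N} {x p q : Fin N} → p ≢ q → x ∈ₑ (p , q) →
  (x ≡ p × opposite x (p , q) ≡ q) ⊎ (x ≡ q × opposite x (p , q) ≡ p)
opposite-spec {p = p} p≢q (inj₁ refl) with p ≟ p
... | yes _ = inj₁ (refl , refl)
... | no p≢p = contradiction refl p≢p
opposite-spec {p = p} {q} p≢q (inj₂ refl) with q ≟ p
... | yes q≡p = contradiction (sym q≡p) p≢q
... | no _ = inj₂ (refl , refl)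

module _ {N : ℕ} {x p q : Fin N} (p≢q : p ≢ q) (x∈e : x ∈ₑ (p , q)) where

  opposite-∈ₑ : opposite x (p , q) ∈ₑ (p , q)
  opposite-∈ₑ with opposite-spec p≢q x∈e
  ... | inj₁ (_ , eq) = inj₂ eq
  ... | inj₂ (_ , eq) = inj₁ eq

  opposite-involutive : opposite (opposite x (p , q)) (p , q) ≡ x
  opposite-involutive with opposite-spec p≢q x∈e | opposite-spec p≢q opposite-∈ₑ
  ... | inj₁ (refl , eq) | inj₂ (_ , eq′) = eq′
  ... | inj₂ (refl , eq) | inj₁ (_ , eq′) = eq′
  ... | inj₁ (refl , eq) | inj₁ (eq″ , _) = contradiction (sym (trans (sym eq) eq″)) p≢q
  ... | inj₂ (refl , eq) | inj₂ (eq″ , _) = contradiction (trans (sym eq) eq″) p≢q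

  ∈ₑ⇒≡⊎≡opposite : ∀ {y} → y ∈ₑ (p , q) → y ≡ x ⊎ y ≡ opposite x (p , q)
  ∈ₑ⇒≡⊎≡opposite y∈e with opposite-spec p≢q x∈e | y∈e
  ... | inj₁ (refl , _) | inj₁ refl = inj₁ refl
  ... | inj₁ (refl , eq) | inj₂ refl = inj₂ (sym eq)
  ... | inj₂ (refl , eq) | inj₁ refl = inj₂ (sym eq)
  ... | inj₂ (refl , _) | inj₂ refl = inj₁ refl

Bichromatic : ∀ {N} → (Fin N → Bool) → Edge N → Set
Bichromatic c (p , q) = c p ≢ c q

ColouredEdge : ℕ → ℕ → Set
ColouredEdge N D = Edge N × Fin D

edgesOf : ∀ {N D} → List (ColouredEdge N D) → List (Edge N)
edgesOf = map proj₁

Compatible : ∀ {N D} → ColouredEdge N D → ColouredEdge N D → Set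
Compatible (e , i) (f , j) = i ≡ j → Disjoint e f

Proper : ∀ {N D} → List (ColouredEdge N D) → Set
Proper = AllPairs Compatible

Free : ∀ {N D} → Fin D → Fin N → List (ColouredEdge N D) → Set
Free a x L = ∀ {e} → (e , a) ∈L L → ¬ x ∈ₑ e

allPairs-∈ : ∀ {A : Set} {R : A → A → Set} {xs : List A} {x y : A} →
  AllPairs R xs → x ∈L xs → y ∈L xs → x ≡ y ⊎ R x y ⊎ R y x
allPairs-∈ (_ ∷ _) (here refl) (here refl) = inj₁ refl
allPairs-∈ (Rx ∷ _) (here refl) (there y∈) = inj₂ (inj₁ (All.lookup Rx y∈))
allPairs-∈ (Rx ∷ _) (there x∈) (here refl) = inj₂ (inj₂ (All.lookup Rx x∈))
allPairs-∈ (_ ∷ Rxs) (there x∈) (there y∈) = allPairs-∈ Rxs x∈ y∈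

allPairs-map-∈ : ∀ {A B : Set} {R : A → A → Set} {S : B → B → Set} {f : A → B} {xs : List A} →
  (∀ {x y} → x ∈L xs → y ∈L xs → R x y → S (f x) (f y)) →
  AllPairs R xs → AllPairs S (map f xs)
allPairs-map-∈ preserves [] = []
allPairs-map-∈ preserves (Rx ∷ Rxs) =
  All-map⁺ (All.tabulate λ y∈ → preserves (here refl) (there y∈) (All.lookup Rx y∈))
  ∷ allPairs-map-∈ (λ x∈ y∈ → preserves (there x∈) (there y∈)) Rxs

proper-unique : ∀ {N D} {L : List (ColouredEdge N D)} {x : Fin N} {e f : Edge N} {k : Fin D} →
  Proper L → (e , k) ∈L L → (f , k) ∈L L → x ∈ₑ e → x ∈ₑ f → e ≡ f
proper-unique {e = e} {f} proper e∈ f∈ x∈e x∈f with allPairs-∈ proper e∈ f∈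
... | inj₁ eq = cong proj₁ eq
... | inj₂ (inj₁ compat) = contradiction (compat refl) (shared⇒¬disjoint e f x∈e x∈f)
... | inj₂ (inj₂ compat) = contradiction (compat refl) (shared⇒¬disjoint f e x∈f x∈e)

proper-∷ : ∀ {N D} {L : List (ColouredEdge N D)} {u v : Fin N} {a : Fin D} →
  Proper L → Free a u L → Free a v L → Proper (((u , v) , a) ∷ L)
proper-∷ {L = L} {u} {v} proper u-free v-free = All.tabulate compatible ∷ proper
  where
  compatible : ∀ {y} → y ∈L L → Compatible ((u , v) , _) y
  compatible {f , _} f∈ refl with disjoint⊎shared (u , v) f
  ... | inj₁ disjoint = disjoint
  ... | inj₂ (_ , inj₁ refl , x∈f) = contradiction x∈f (u-free f∈)
  ... | inj₂ (_ , inj₂ refl , x∈f) = contradiction x∈f (v-free f∈)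

Orbit : ∀ {N} → (Fin N → Fin N) → Fin N → Fin N → Set
Orbit f v y = ∃ λ k → fold v f k ≡ y

orbit-bounded : ∀ {N} (f : Fin N → Fin N) (v : Fin N) (k : ℕ) →
  ∃ λ (i : Fin (suc N)) → fold v f (toℕ i) ≡ fold v f k
orbit-bounded {N} f v = <-rec Reached bounded
  where
  Reached : ℕ → Set
  Reached k = ∃ λ (i : Fin (suc N)) → fold v f (toℕ i) ≡ fold v f k

  bounded : ∀ k → (∀ {j} → j < k → Reached j) → Reached k
  bounded k rec with k <? suc N
  ... | yes k<1+N = fromℕ< k<1+N , cong (fold v f) (toℕ-fromℕ< k<1+N)
  ... | no k≮1+N with pigeonhole (n<1+n N) (λ i → fold v f (toℕ i))
  ... | i , j , i<j , fᵢ≡fⱼ = let (i′ , eq) = rec shorter in i′ , trans eq shortcut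
    where
    t = k ∸ toℕ j
    t+j≡k : t + toℕ j ≡ k
    t+j≡k = m∸n+n≡m (≤-trans (<⇒≤ (toℕ<n j)) (≮⇒≥ k≮1+N))
    shorter : t + toℕ i < k
    shorter = subst (t + toℕ i <_) t+j≡k (+-monoʳ-< t i<j)
    shortcut : fold v f (t + toℕ i) ≡ fold v f k
    shortcut = begin
      fold v f (t + toℕ i)           ≡⟨ fold-+ v f t ⟩
      fold (fold v f (toℕ i)) f t    ≡⟨ cong (λ z → fold z f t) fᵢ≡fⱼ ⟩
      fold (fold v f (toℕ j)) f t    ≡⟨ fold-+ v f t ⟨
      fold v f (t + toℕ j)           ≡⟨ cong (fold v f) t+j≡k ⟩
      fold v f k                     ∎
      where open ≡-Reasoning

orbit? : ∀ {N} (f : Fin N → Fin N) (v : Fin N) → Decidable (Orbit f v)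
orbit? f v y = map′ (λ (i , eq) → toℕ i , eq) bound (any? (λ i → fold v f (toℕ i) ≟ y))
  where
  bound : Orbit f v y → ∃ λ i → fold v f (toℕ i) ≡ y
  bound (k , eq) = let (i , eq′) = orbit-bounded f v k in i , trans eq′ eq

module KempeChain {N D : ℕ} (c : Fin N → Bool) {L : List (ColouredEdge N D)} (proper : Proper L)
  (bichromatic : ∀ {e i} → (e , i) ∈L L → Bichromatic c e)
  {a b : Fin D} (a≢b : a ≢ b) {u v : Fin N} (cu≢cv : c u ≢ c v)
  (a-free : Free a u L) (b-free : Free b v L) where

  IsAB : Fin D → Set
  IsAB i = i ≡ a ⊎ i ≡ b

  -- The Kempe chain from v leaves each vertex by its edge of colour outColour:
  -- a on v's side of the bipartition, b on the other side.
  outColour inColour : Fin N → Fin D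
  outColour x = if c x xor c v then b else a
  inColour x = if c x xor c v then a else b

  outColour≡inColour : ∀ {x y} → c x ≢ c y → outColour x ≡ inColour y
  outColour≡inColour {x} {y} cx≢cy with c x | c y | c v
  ... | true | true | _ = contradiction refl cx≢cy
  ... | false | false | _ = contradiction refl cx≢cy
  ... | true | false | true = refl
  ... | true | false | false = refl
  ... | false | true | true = refl
  ... | false | true | false = refl

  inColour-v : inColour v ≡ b
  inColour-v with c v
  ... | true = refl
  ... | false = refl

  inColour-u : inColour u ≡ a
  inColour-u with c u | c v
  ... | true | true = contradiction refl cu≢cv
  ... | true | false = refl
  ... | false | true = refl
  ... | false | false = contradiction refl cu≢cv

  isAB⇒out⊎in : ∀ x {i} → IsAB i → i ≡ outColour x ⊎ i ≡ inColour x
  isAB⇒out⊎in x ab with c x xor c v | ab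
  ... | true | inj₁ i≡a = inj₂ i≡a
  ... | true | inj₂ i≡b = inj₁ i≡b
  ... | false | ab′ = ab′

  non-loop : ∀ {e i} → (e , i) ∈L L → proj₁ e ≢ proj₂ e
  non-loop e∈ p≡q = bichromatic e∈ (cong c p≡q)

  opposite-side : ∀ {e i x} → (e , i) ∈L L → x ∈ₑ e → c x ≢ c (opposite x e)
  opposite-side e∈ x∈e with opposite-spec (non-loop e∈) x∈e
  ... | inj₁ (refl , eq) = λ same → bichromatic e∈ (trans same (cong c eq))
  ... | inj₂ (refl , eq) = λ same → bichromatic e∈ (sym (trans same (cong c eq)))

  EdgeAt : Fin N → Fin D → Set
  EdgeAt x k = ∃ λ e → (e , k) ∈L L × x ∈ₑ e

  edgeAt? : ∀ x k → Dec (EdgeAt x k)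
  edgeAt? x k = map′ found (λ (_ , e∈ , x∈e) → lose e∈ (x∈e , refl))
                     (Any.any? (λ (e , i) → x ∈ₑ? e ×-dec i ≟ k) L)
    where
    found : Any.Any (λ (e , i) → x ∈ₑ e × i ≡ k) L → EdgeAt x k
    found any with find any
    ... | (e , _) , e∈ , x∈e , refl = e , e∈ , x∈e

  -- The opaque blocks only keep type checking fast: unfolding next, chain? or free-colour
  -- during unification produces very large terms.
  opaque
    next : Fin N → Fin N
    next x with edgeAt? x (outColour x)
    ... | yes (e , _) = opposite x e
    ... | no _ = x

    next-spec : ∀ x → (∃ λ e → (e , outColour x) ∈L L × x ∈ₑ e × next x ≡ opposite x e)
                    ⊎ (¬ EdgeAt x (outColour x) × next x ≡ x)
    next-spec x with edgeAt? x (outColour x)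
    ... | yes (e , e∈ , x∈e) = inj₁ (e , e∈ , x∈e , refl)
    ... | no none = inj₂ (none , refl)

  next-along : ∀ {e x} → (e , outColour x) ∈L L → x ∈ₑ e → next x ≡ opposite x e
  next-along {e} {x} e∈ x∈e with next-spec x
  ... | inj₁ (e′ , e′∈ , x∈e′ , moves) =
        trans moves (cong (opposite x) (proper-unique proper e′∈ e∈ x∈e′ x∈e))
  ... | inj₂ (none , _) = contradiction (e , e∈ , x∈e) none

  Chain : Fin N → Set
  Chain = Orbit next v

  opaque
    chain? : Decidable Chain
    chain? = orbit? next v

  predecessor : ∀ k {x} → fold v next (suc k) ≡ x →
    fold v next k ≡ x ⊎
    ∃ λ e → (e , inColour x) ∈L L × x ∈ₑ e × opposite x e ≡ fold v next k
  predecessor k {x} eq with next-spec (fold v next k)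
  ... | inj₂ (_ , stays) = inj₁ (trans (sym stays) eq)
  ... | inj₁ (e , e∈ , y∈e , moves) =
        inj₂ (e , subst (λ i → (e , i) ∈L L) out≡in e∈ , x∈e , back)
    where
    y = fold v next k
    x≡ : x ≡ opposite y e
    x≡ = trans (sym eq) moves
    x∈e : x ∈ₑ e
    x∈e = subst (_∈ₑ e) (sym x≡) (opposite-∈ₑ (non-loop e∈) y∈e)
    out≡in : outColour y ≡ inColour x
    out≡in = outColour≡inColour (subst (λ z → c y ≢ c z) (sym x≡) (opposite-side e∈ y∈e))
    back : opposite x e ≡ y
    back = trans (cong (λ z → opposite z e) x≡) (opposite-involutive (non-loop e∈) y∈e)

  chain-closed-inColour : ∀ k {e x} → (e , inColour x) ∈L L → x ∈ₑ e →
    fold v next k ≡ x → Chain (opposite x e)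
  chain-closed-inColour zero e∈ v∈e refl =
    contradiction v∈e (b-free (subst (λ i → (_ , i) ∈L L) inColour-v e∈))
  chain-closed-inColour (suc k) {e} {x} e∈ x∈e eq with predecessor k eq
  ... | inj₁ stays = chain-closed-inColour k e∈ x∈e stays
  ... | inj₂ (e′ , e′∈ , x∈e′ , back) =
        k , trans (sym back) (cong (opposite x) (proper-unique proper e′∈ e∈ x∈e′ x∈e))

  chain-closed-outColour : ∀ {e x} → (e , outColour x) ∈L L → x ∈ₑ e →
    Chain x → Chain (opposite x e)
  chain-closed-outColour e∈ x∈e (k , eq) = suc k , trans (cong next eq) (next-along e∈ x∈e)

  chain-closed : ∀ {e i x y} → (e , i) ∈L L → IsAB i → x ∈ₑ e → y ∈ₑ e →
    Chain x → Chain y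
  chain-closed {x = x} e∈ ab x∈e y∈e chain-x
    with ∈ₑ⇒≡⊎≡opposite (non-loop e∈) x∈e y∈e | isAB⇒out⊎in x ab
  ... | inj₁ refl | _ = chain-x
  ... | inj₂ refl | inj₁ refl = chain-closed-outColour e∈ x∈e chain-x
  ... | inj₂ refl | inj₂ refl = chain-closed-inColour (proj₁ chain-x) e∈ x∈e (proj₂ chain-x)

  -- u lies on the other side from v, so the chain could only enter u by an a-edge.
  u∉chain : ¬ Chain u
  u∉chain (k , eq) = never k eq
    where
    never : ∀ k → fold v next k ≢ u
    never zero v≡u = cu≢cv (cong c (sym v≡u))
    never (suc k) eq with predecessor k eq
    ... | inj₁ stays = never k stays
    ... | inj₂ (e , e∈ , u∈e , _) = a-free (subst (λ i → (e , i) ∈L L) inColour-u e∈) u∈e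

  σ : Fin D → Fin D
  σ = transpose a b

  σ-cases : ∀ i →
    (i ≡ a × σ i ≡ b) ⊎ (i ≡ b × σ i ≡ a) ⊎ (i ≢ a × i ≢ b × σ i ≡ i)
  σ-cases i with i ≟ a | i ≟ b
  ... | yes refl | _ = inj₁ (refl , refl)
  ... | no i≢a | yes refl rewrite dec-true (i ≟ i) refl = inj₂ (inj₁ (refl , refl))
  ... | no i≢a | no i≢b rewrite dec-false (i ≟ b) i≢b = inj₂ (inj₂ (i≢a , i≢b , refl))

  σ-injective : ∀ {i j} → σ i ≡ σ j → i ≡ j
  σ-injective eq =
    trans (sym (transpose-inverse b a)) (trans (cong (transpose b a) eq) (transpose-inverse b a))

  σ≡a⇒≡b : ∀ {i} → σ i ≡ a → i ≡ b
  σ≡a⇒≡b {i} σi≡a with σ-cases i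
  ... | inj₁ (_ , σi≡b) = contradiction (trans (sym σi≡a) σi≡b) a≢b
  ... | inj₂ (inj₁ (i≡b , _)) = i≡b
  ... | inj₂ (inj₂ (i≢a , _ , σi≡i)) = contradiction (trans (sym σi≡i) σi≡a) i≢a

  swapIf : ∀ {P : Set} → Dec P → Fin D → Fin D
  swapIf (yes _) = σ
  swapIf (no _) i = i

  recolour : ColouredEdge N D → ColouredEdge N D
  recolour (e , i) = e , swapIf (chain? (proj₁ e)) i

  chain-spreads : ∀ {e f i j x} → (e , i) ∈L L → (f , j) ∈L L → IsAB i → IsAB j →
    x ∈ₑ e → x ∈ₑ f → Chain (proj₁ e) → Chain (proj₁ f)
  chain-spreads e∈ f∈ ab-i ab-j x∈e x∈f =
    chain-closed f∈ ab-j x∈f (inj₁ refl) ∘ chain-closed e∈ ab-i (inj₁ refl) x∈e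

  -- The a/b-edges at a chain vertex belong to the chain, so an edge that is swapped and
  -- one that is not cannot both be a/b-edges at the same vertex.
  swap-across : ∀ {e f i j x} → (e , i) ∈L L → (f , j) ∈L L → x ∈ₑ e → x ∈ₑ f →
    Chain (proj₁ e) → ¬ Chain (proj₁ f) → σ i ≡ j → i ≡ j
  swap-across {i = i} e∈ f∈ x∈e x∈f chain-e ¬chain-f σi≡j with σ-cases i
  ... | inj₁ (i≡a , σi≡b) = contradiction
        (chain-spreads e∈ f∈ (inj₁ i≡a) (inj₂ (trans (sym σi≡j) σi≡b)) x∈e x∈f chain-e) ¬chain-f
  ... | inj₂ (inj₁ (i≡b , σi≡a)) = contradiction
        (chain-spreads e∈ f∈ (inj₂ i≡b) (inj₁ (trans (sym σi≡j) σi≡a)) x∈e x∈f chain-e) ¬chain-f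
  ... | inj₂ (inj₂ (_ , _ , σi≡i)) = trans (sym σi≡i) σi≡j

  swapIf-injective-at : ∀ {e f i j x} →
    (e , i) ∈L L → (f , j) ∈L L → x ∈ₑ e → x ∈ₑ f →
    (chain-e? : Dec (Chain (proj₁ e))) (chain-f? : Dec (Chain (proj₁ f))) →
    swapIf chain-e? i ≡ swapIf chain-f? j → i ≡ j
  swapIf-injective-at _ _ _ _ (yes _) (yes _) same = σ-injective same
  swapIf-injective-at _ _ _ _ (no _) (no _) same = same
  swapIf-injective-at e∈ f∈ x∈e x∈f (yes chain-e) (no ¬chain-f) same =
    swap-across e∈ f∈ x∈e x∈f chain-e ¬chain-f same
  swapIf-injective-at e∈ f∈ x∈e x∈f (no ¬chain-e) (yes chain-f) same =
    sym (swap-across f∈ e∈ x∈f x∈e chain-f ¬chain-e (sym same))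

  recolour-compatible : ∀ {p q} → p ∈L L → q ∈L L →
    Compatible p q → Compatible (recolour p) (recolour q)
  recolour-compatible {e , _} {f , _} e∈ f∈ compatible same with disjoint⊎shared e f
  ... | inj₁ disjoint = disjoint
  ... | inj₂ (_ , x∈e , x∈f) =
        compatible (swapIf-injective-at e∈ f∈ x∈e x∈f (chain? (proj₁ e)) (chain? (proj₁ f)) same)

  NoSwapToAAt : Fin N → Set
  NoSwapToAAt x = ∀ {e i} → (e , i) ∈L L → x ∈ₑ e →
    (chain-e? : Dec (Chain (proj₁ e))) → swapIf chain-e? i ≢ a

  recolour-free : ∀ {x} → NoSwapToAAt x → Free a x (map recolour L)
  recolour-free never e∈′ x∈e with ∈-map⁻ recolour e∈′
  ... | (e , i) , e∈ , eq with cong proj₁ eq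
  ... | refl = never e∈ x∈e (chain? (proj₁ e)) (sym (cong proj₂ eq))

  no-swap-to-a-at-u : NoSwapToAAt u
  no-swap-to-a-at-u e∈ u∈e (yes chain-e) σi≡a =
    u∉chain (chain-closed e∈ (inj₂ (σ≡a⇒≡b σi≡a)) (inj₁ refl) u∈e chain-e)
  no-swap-to-a-at-u e∈ u∈e (no _) refl = a-free e∈ u∈e

  no-swap-to-a-at-v : NoSwapToAAt v
  no-swap-to-a-at-v {e} e∈ v∈e (yes _) σi≡a =
    b-free (subst (λ k → (e , k) ∈L L) (σ≡a⇒≡b σi≡a) e∈) v∈e
  no-swap-to-a-at-v e∈ v∈e (no ¬chain-e) i≡a =
    ¬chain-e (chain-closed e∈ (inj₁ i≡a) v∈e (inj₁ refl) (zero , refl))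

  kempe-swap : ∃ λ L′ → edgesOf L′ ≡ edgesOf L × Proper L′ × Free a u L′ × Free a v L′
  kempe-swap = map recolour L , sym (map-∘ L) , allPairs-map-∈ recolour-compatible proper ,
               recolour-free no-swap-to-a-at-u , recolour-free no-swap-to-a-at-v

degreeIn : ∀ {N} → Fin N → List (Edge N) → ℕ
degreeIn x F = length (filterᵇ (incidentᵇ x) F)

degreeIn-∷ : ∀ {N} (x : Fin N) {e F} → degreeIn x F ≤ degreeIn x (e ∷ F)
degreeIn-∷ x {e} with incidentᵇ x e
... | true = n≤1+n _
... | false = ≤-refl

degreeIn-∷-∈ₑ : ∀ {N} {x : Fin N} {e F} → x ∈ₑ e → degreeIn x (e ∷ F) ≡ suc (degreeIn x F)
degreeIn-∷-∈ₑ {x = x} {e} x∈e =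
  cong length (filter-accept (T? ∘ incidentᵇ x) (∈ₑ⇒incidentᵇ e x∈e))

length<⇒∃∉ : ∀ {D} (cs : List (Fin D)) → length cs < D → ∃ λ a → a ∉ cs
length<⇒∃∉ {D} cs short = ¬∀⟶∃¬ D (_∈L cs) (λ a → Any.any? (a ≟_) cs) ¬all
  where
  ¬all : ¬ (∀ a → a ∈L cs)
  ¬all every with pigeonhole short (index ∘ every)
  ... | i , j , i<j , same = <⇒≢ i<j (begin
    i                           ≡⟨ lookup-index (every i) ⟩
    lookup cs (index (every i)) ≡⟨ cong (lookup cs) same ⟩
    lookup cs (index (every j)) ≡⟨ lookup-index (every j) ⟨
    j                           ∎)
    where open ≡-Reasoning

coloursAt : ∀ {N D} → Fin N → List (ColouredEdge N D) → List (Fin D)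
coloursAt x L = map proj₂ (filterᵇ (incidentᵇ x ∘ proj₁) L)

length-coloursAt : ∀ {N D} (x : Fin N) (L : List (ColouredEdge N D)) →
  length (coloursAt x L) ≡ degreeIn x (edgesOf L)
length-coloursAt x [] = refl
length-coloursAt x ((e , _) ∷ L) with incidentᵇ x e
... | true = cong suc (length-coloursAt x L)
... | false = length-coloursAt x L

opaque
  free-colour : ∀ {N D} {x : Fin N} {L : List (ColouredEdge N D)} →
    degreeIn x (edgesOf L) < D → ∃ λ a → Free a x L
  free-colour {x = x} {L} room
    with length<⇒∃∉ (coloursAt x L) (subst (_< _) (sym (length-coloursAt x L)) room)
  ... | a , a∉ = a , λ {e} e∈ x∈e →
    a∉ (∈-map⁺ proj₂ (∈-filter⁺ (T? ∘ incidentᵇ x ∘ proj₁) e∈ (∈ₑ⇒incidentᵇ e x∈e)))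

extend-colouring : ∀ {N D} (c : Fin N → Bool) {L : List (ColouredEdge N D)} {u v : Fin N} →
  Proper L →
  (∀ {e i} → (e , i) ∈L L → Bichromatic c e) → c u ≢ c v →
  degreeIn u (edgesOf L) < D → degreeIn v (edgesOf L) < D →
  ∃ λ L′ → edgesOf L′ ≡ (u , v) ∷ edgesOf L × Proper L′
extend-colouring c {L} {u} {v} proper bichromatic cu≢cv u-room v-room
  with free-colour u-room | free-colour v-room
... | a , a-free | b , b-free with a ≟ b
... | yes refl = ((u , v) , a) ∷ L , refl , proper-∷ proper a-free b-free
... | no a≢b with KempeChain.kempe-swap c proper bichromatic a≢b cu≢cv a-free b-free
... | L′ , same , proper′ , a-free-u , a-free-v =
  ((u , v) , a) ∷ L′ , cong ((u , v) ∷_) same , proper-∷ proper′ a-free-u a-free-v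

bipartite-edge-colouring : ∀ {N D} (c : Fin N → Bool) (F : List (Edge N)) →
  All (Bichromatic c) F → (∀ x → degreeIn x F ≤ D) →
  ∃ λ (L : List (ColouredEdge N D)) → edgesOf L ≡ F × Proper L
bipartite-edge-colouring c [] _ _ = [] , refl , []
bipartite-edge-colouring c ((u , v) ∷ F) (cu≢cv ∷ bichromatic) bounded
  with bipartite-edge-colouring c F bichromatic (λ x → ≤-trans (degreeIn-∷ x) (bounded x))
... | L , refl , proper =
  extend-colouring c proper (All.lookup bichromatic ∘ ∈-map⁺ proj₁) cu≢cv
    (room (inj₁ refl)) (room (inj₂ refl))
  where
  room : ∀ {x} → x ∈ₑ (u , v) → degreeIn x (edgesOf L) < _
  room {x} x∈e = subst (_≤ _) (degreeIn-∷-∈ₑ {F = edgesOf L} x∈e) (bounded x)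

degreeIn-filter : ∀ {N} (x : Fin N) (q : Edge N → Bool) F → degreeIn x (filterᵇ q F) ≤ degreeIn x F
degreeIn-filter x q F =
  length-mono-≤ (Sublist.filter⁺ (T? ∘ incidentᵇ x) (T? ∘ incidentᵇ x) (λ { refl p → p })
                                 (filter-⊆ (T? ∘ q) F))

≤-foldr-⊔ : ∀ {n ns} → n ∈L ns → n ≤ foldr _⊔_ 0 ns
≤-foldr-⊔ {ns = n ∷ _} (here refl) = m≤m⊔n n _
≤-foldr-⊔ {ns = m ∷ _} (there n∈) = ≤-trans (≤-foldr-⊔ n∈) (m≤n⊔m m _)

colourClass : ∀ {N D} → Fin D → List (ColouredEdge N D) → List (Edge N)
colourClass k L = map proj₁ (filter ((_≟ k) ∘ proj₂) L)

colourClass-⊆ : ∀ {N D} {k : Fin D} {L : List (ColouredEdge N D)} {e} →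
  e ∈L colourClass k L → e ∈L edgesOf L
colourClass-⊆ {k = k} e∈ with ∈-map⁻ proj₁ e∈
... | _ , p∈ , refl = ∈-map⁺ proj₁ (proj₁ (∈-filter⁻ ((_≟ k) ∘ proj₂) p∈))

colourClass-matching : ∀ {N D} (k : Fin D) {L : List (ColouredEdge N D)} →
  Proper L → AllPairs Disjoint (colourClass k L)
colourClass-matching k {L} proper = AllPairs.map⁺
  (monochromatic (all-filter ((_≟ k) ∘ proj₂) L) (AllPairs.filter⁺ ((_≟ k) ∘ proj₂) proper))
  where
  monochromatic : ∀ {xs} → All ((_≡ k) ∘ proj₂) xs →
    AllPairs Compatible xs → AllPairs (Disjoint on proj₁) xs
  monochromatic [] [] = []
  monochromatic (x≡k ∷ xs≡k) (compatible ∷ compatibles) =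
    All.zipWith (λ (compat , y≡k) → compat (trans x≡k (sym y≡k))) (compatible , xs≡k)
    ∷ monochromatic xs≡k compatibles

∑-indicator : ∀ {D} (i : Fin D) (x : ℕ) → ∑[ k < D ] (if does (i ≟ k) then x else 0) ≡ x
∑-indicator {suc D} zero x = trans (cong (x +_) (sum-replicate-zero D)) (+-identityʳ x)
∑-indicator (suc i) x = ∑-indicator i x

weight-colourClass-∷ : ∀ {N D} (w : Edge N → ℕ) (k : Fin D) e i L →
  weight w (colourClass k ((e , i) ∷ L)) ≡
  (if does (i ≟ k) then w e else 0) + weight w (colourClass k L)
weight-colourClass-∷ w k e i L with does (i ≟ k)
... | true = refl
... | false = refl

weight-colourClasses : ∀ {N D} (w : Edge N → ℕ) (L : List (ColouredEdge N D)) →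
  weight w (edgesOf L) ≡ ∑[ k < D ] weight w (colourClass k L)
weight-colourClasses {D = D} w [] = sym (sum-replicate-zero D)
weight-colourClasses {D = D} w ((e , i) ∷ L) = begin
  w e + weight w (edgesOf L)
    ≡⟨ cong₂ _+_ (sym (∑-indicator i (w e))) (weight-colourClasses w L) ⟩
  ∑[ k < D ] (if does (i ≟ k) then w e else 0) + ∑[ k < D ] weight w (colourClass k L)
    ≡⟨ ∑-distrib-+ (λ k → if does (i ≟ k) then w e else 0) (λ k → weight w (colourClass k L)) ⟨
  ∑[ k < D ] ((if does (i ≟ k) then w e else 0) + weight w (colourClass k L))
    ≡⟨ sum-cong-≗ (λ k → weight-colourClass-∷ w k e i L) ⟨
  ∑[ k < D ] weight w (colourClass k ((e , i) ∷ L))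
    ∎
  where open ≡-Reasoning

averaging : ∀ {D} k (s : Fin D → ℕ) →
  0 < ∑[ i < D ] s i → D * k ≤ ∑[ i < D ] s i → ∃ λ i → k ≤ s i
averaging {zero} k s () _
averaging {suc D} k s _ large with k ≤? s zero
... | yes k≤s₀ = zero , k≤s₀
... | no k≰s₀ = Product.map suc id
  (averaging k (s ∘ suc) (<-≤-trans (s≤s z≤n) rest-large) (≤-trans (n≤1+n _) rest-large))
  where
  rest-large : suc (D * k) ≤ ∑[ i < D ] s (suc i)
  rest-large = +-cancelˡ-≤ (s zero) _ _ (begin
    s zero + suc (D * k)         ≡⟨ +-suc (s zero) (D * k) ⟩
    suc (s zero) + D * k         ≤⟨ +-monoˡ-≤ (D * k) (≰⇒> k≰s₀) ⟩
    k + D * k                    ≤⟨ large ⟩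
    s zero + ∑[ i < D ] s (suc i) ∎)
    where open ≤-Reasoning

heavy-matching : ∀ {N D} (c : Fin N → Bool) (w : Edge N → ℕ) (k : ℕ) (F : List (Edge N)) →
  All (Bichromatic c) F → (∀ x → degreeIn x F ≤ D) →
  0 < weight w F → D * k ≤ weight w F → ∃ λ M → MatchingIn F M × k ≤ weight w M
heavy-matching c w k F bichromatic bounded positive large
  with bipartite-edge-colouring c F bichromatic bounded
... | L , refl , proper with averaging k (λ i → weight w (colourClass i L))
                                (subst (0 <_) (weight-colourClasses w L) positive)
                                (subst (_ ≤_) (weight-colourClasses w L) large)
... | i , heavy = colourClass i L , (All.tabulate colourClass-⊆ , colourClass-matching i proper) , heavy

proposition1 : (G : Graph) → Bipartite G →
    (w : Edge (n G) → ℕ) → PositiveWeights G w →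
    (k₁ k₂ k₃ : ℕ) → 1 ≤ k₁ → 1 ≤ k₂ → 1 ≤ k₃ →
    Δ G * k₃ ≤ k₂ →
    M-EPVCB G w k₁ k₂ k₃ ⇔ EPVCB G w k₁ k₂
proposition1 G (c , bipartite) w _ k₁ k₂ k₃ _ 1≤k₂ _ Δk₃≤k₂ = mk⇔ forget-matching add-matching
  where
  forget-matching : M-EPVCB G w k₁ k₂ k₃ → EPVCB G w k₁ k₂
  forget-matching (V₀ , small , heavy , _) = V₀ , small , heavy

  add-matching : EPVCB G w k₁ k₂ → M-EPVCB G w k₁ k₂ k₃
  add-matching (V₀ , small , heavy) =
    V₀ , small , heavy ,
    heavy-matching c w k₃ (E[ G ] V₀) (All-filter⁺ (T? ∘ touchesᵇ V₀) bipartite) degree-bound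
      (≤-trans 1≤k₂ heavy) (≤-trans Δk₃≤k₂ heavy)
    where
    degree-bound : ∀ x → degreeIn x (E[ G ] V₀) ≤ Δ G
    degree-bound x = ≤-trans (degreeIn-filter x (touchesᵇ V₀) (edges G))
                             (≤-foldr-⊔ (∈-map⁺ (degree G) (∈-allFin x)))
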